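{- For every graph $G$ of order $n$ that is a disjoint union of paths, the number of minimal Roman dominating functions of $G$ is $\mathcal{O}(\sqrt{3}^{\,n})$; moreover, this bound is attained by disjoint unions of copies of $P_2$ (the path on two vertices).
   Context: For a graph $G=(V,E)$, a function $f\colon V\to\{0,1,2\}$ is a Roman dominating function (rdf) if every vertex $v$ with $f(v)=0$ has a neighbor $u$ with $f(u)=2$. Functions $V\to\{0,1,2\}$ are ordered pointwise: $f\le g$ iff $f(v)\le g(v)$ for all $v$. An rdf $f$ is minimal if there is no rdf $g\neq f$ with $g\le f$. -}

module Defs where

open import Data.Nat using (ℕ; zero; suc; _≤_)
open import Data.Fin using (Fin; toℕ; splitAt)
open import Data.Sum using (_⊎_; inj₁; inj₂)
open import Data.Product using (Σ; ∃; _×_)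
open import Data.Empty using (⊥)
open import Data.List using (List; []; _∷_; replicate)
open import Data.Nat.ListAction using (sum)
open import Relation.Binary.PropositionalEquality using (_≡_; _≢_)
open import Function.Bundles using (_↔_; Inverse; _⇔_)

Graph : ℕ → Set₁
Graph n = Fin n → Fin n → Set

Path : (m : ℕ) → Graph m
Path m i j = (toℕ j ≡ suc (toℕ i)) ⊎ (toℕ i ≡ suc (toℕ j))

adjSum : {m k : ℕ} → Graph m → Graph k → Fin m ⊎ Fin k → Fin m ⊎ Fin k → Set
adjSum G H (inj₁ x) (inj₁ y) = G x y
adjSum G H (inj₂ x) (inj₂ y) = H x y
adjSum G H (inj₁ x) (inj₂ y) = ⊥
adjSum G H (inj₂ x) (inj₁ y) = ⊥

_⊕_ : {m k : ℕ} → Graph m → Graph k → Graph (m Data.Nat.+ k)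
_⊕_ {m} G H x y = adjSum G H (splitAt m x) (splitAt m y)

PathUnion : (ls : List ℕ) → Graph (sum ls)
PathUnion [] ()
PathUnion (l ∷ ls) = Path l ⊕ PathUnion ls

Iso : {n m : ℕ} → Graph n → Graph m → Set
Iso {n} {m} G H =
  Σ (Fin n ↔ Fin m) λ σ → ∀ u v → G u v ⇔ H (Inverse.to σ u) (Inverse.to σ v)

IsDisjointUnionOfPaths : {n : ℕ} → Graph n → Set
IsDisjointUnionOfPaths G = Σ (List ℕ) λ ls → Iso G (PathUnion ls)

kP2 : (k : ℕ) → Graph (sum (replicate k 2))
kP2 k = PathUnion (replicate k 2)

Fun3 : ℕ → Set
Fun3 n = Fin n → Fin 3

IsRDF : {n : ℕ} → Graph n → Fun3 n → Set
IsRDF {n} G f = ∀ v → toℕ (f v) ≡ 0 → ∃ λ u → G v u × toℕ (f u) ≡ 2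

_≤F_ : {n : ℕ} → Fun3 n → Fun3 n → Set
f ≤F g = ∀ v → toℕ (f v) ≤ toℕ (g v)

Distinct : {n : ℕ} → Fun3 n → Fun3 n → Set
Distinct f g = ∃ λ v → f v ≢ g v

IsMinimalRDF : {n : ℕ} → Graph n → Fun3 n → Set
IsMinimalRDF G f = IsRDF G f × (∀ g → IsRDF G g → g ≤F f → (Distinct g f → ⊥))

module Submission where

-- Minimality is a local property on a path: a vertex with value 0 has a neighbour with
-- value 2, a vertex with value 1 has none (else it could be lowered to 0), and a vertex
-- with value 2 has a 0-neighbour that no other 2 dominates (else it could be lowered to 1).
-- These conditions only look at distance ≤ 2, so the minimal rdfs of P_m are among the
-- words of length m accepted by an automaton remembering the last four symbols. If N_s(m)
-- counts the accepted words from state s, evaluation shows N_s(5) ≤ 3 N_s(3) for all 256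
-- states; since N_s(m+1) is a sum of N_{s'}(m) over successor states this propagates to
-- N_s(m+2) ≤ 3 N_s(m) for m ≥ 3, whence N(m)² ≤ 3^m. The minimal rdfs of a disjoint union
-- restrict to minimal rdfs of the components, so the bound multiplies over the paths.
-- Conversely each component of kP₂ may independently carry 20, 02 or 11, giving 3^k
-- minimal rdfs on 2k vertices.

open import Defs
open import Data.Bool using (Bool; true; false; _∧_; _∨_; not; if_then_else_; T)
open import Data.Bool.Properties using (T-∧; T-∨; T?)
open import Data.Empty using (⊥; ⊥-elim)
open import Data.Fin using (Fin; zero; suc; toℕ; opposite; _≟_; _↑ˡ_; _↑ʳ_; join; splitAt)
open import Data.Fin.Permutation using (↔⇒≡)
open import Data.Fin.Properties using (toℕ-injective; injective⇒≤; splitAt-join)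
open import Data.List
  using (List; []; _∷_; _++_; [_]; map; length; lookup; replicate; cartesianProductWith)
open import Data.List.Membership.Propositional using (_∈_)
open import Data.List.Membership.Propositional.Properties
  using (∈-lookup; ∈-map⁺; ∈-++⁺ˡ; ∈-++⁺ʳ; ∈-cartesianProductWith⁺)
open import Data.List.Properties using (length-map; length-++)
open import Data.List.Relation.Unary.All as All using (All; []; _∷_)
import Data.List.Relation.Unary.All.Properties as All
open import Data.List.Relation.Unary.AllPairs as AllPairs using (AllPairs; []; _∷_)
import Data.List.Relation.Unary.AllPairs.Properties as AllPairs
open import Data.List.Relation.Unary.Any using (here; index)
open import Data.List.Relation.Unary.Any.Properties using (lookup-index)
open import Data.List.Relation.Unary.Unique.Propositional using (Unique)
open import Data.Nat using (ℕ; zero; suc; _+_; _*_; _^_; _≤_; _<_; _≤?_; z≤n; s≤s; z<s)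
open import Data.Nat.ListAction using (sum)
open import Data.Nat.Properties
  using (≤-refl; ≤-reflexive; <⇒≤; <⇒≢; n≤0⇒n≡0; m<n+m; suc-injective; +-mono-≤; *-mono-≤;
         *-monoʳ-≤; *-distribˡ-+; *-assoc; *-identityˡ; ^-monoˡ-≤; ^-distribˡ-+-*; ^-*-assoc;
         +-*-commutativeSemiring; module ≤-Reasoning)
open import Algebra.Properties.CommutativeSemiring.Exp +-*-commutativeSemiring using (^-distrib-*)
open import Data.Product using (Σ; ∃; _×_; _,_; proj₁; proj₂)
open import Data.Sum using (inj₁; inj₂; [_,_]′)
open import Data.Unit using (⊤; tt)
open import Data.Vec using (Vec; []; _∷_; tabulate; toList)
  renaming (_++_ to _++ᵛ_; lookup to lookupᵛ)
open import Data.Vec.Functional using (updateAt)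
open import Data.Vec.Functional.Properties using (updateAt-updates; updateAt-minimal)
open import Data.Vec.Properties using (lookup∘tabulate; tabulate-cong)
open import Function using (_∘_; id; const)
open import Function.Bundles using (Inverse; Equivalence)
open import Relation.Binary.PropositionalEquality
  using (_≡_; _≢_; ≢-sym; refl; sym; trans; cong; cong₂; subst; subst₂; module ≡-Reasoning)
open import Relation.Nullary using (¬_; Dec; yes; no; contradiction)
open import Relation.Nullary.Decidable using (map′; _×-dec_; from-yes)

pattern 𝟎 = zero
pattern 𝟏 = suc zero
pattern 𝟐 = suc (suc zero)

lookup-injective : ∀ {A : Set} {xs : List A} → Unique xs →
                   ∀ i j → lookup xs i ≡ lookup xs j → i ≡ j
lookup-injective (_ ∷ _)    zero    zero    _  = refl
lookup-injective (x∉xs ∷ _) zero    (suc j) eq = contradiction eq (All.lookup x∉xs (∈-lookup j))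
lookup-injective (x∉xs ∷ _) (suc i) zero    eq = contradiction (sym eq) (All.lookup x∉xs (∈-lookup i))
lookup-injective (_ ∷ xs!)  (suc i) (suc j) eq = cong suc (lookup-injective xs! i j eq)

unique∧⊆⇒length≤ : ∀ {A : Set} {xs ys : List A} → Unique xs → All (_∈ ys) xs →
                   length xs ≤ length ys
unique∧⊆⇒length≤ {xs = xs} {ys} xs! xs⊆ys = injective⇒≤ λ {i} {j} eq →
  lookup-injective xs! i j (begin
    lookup xs i                    ≡⟨ lookup-index (position i) ⟩
    lookup ys (index (position i)) ≡⟨ cong (lookup ys) eq ⟩
    lookup ys (index (position j)) ≡⟨ lookup-index (position j) ⟨
    lookup xs j                    ∎)
  where
  open ≡-Reasoning
  position : ∀ i → lookup xs i ∈ ys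
  position i = All.lookup xs⊆ys (∈-lookup i)

length-cartesianProductWith : ∀ {A B C : Set} (f : A → B → C) xs ys →
  length (cartesianProductWith f xs ys) ≡ length xs * length ys
length-cartesianProductWith f []       ys = refl
length-cartesianProductWith f (x ∷ xs) ys = trans (length-++ (map (f x) ys))
  (cong₂ _+_ (length-map (f x) ys) (length-cartesianProductWith f xs ys))

module _ {A B C : Set} (f : A → B → C) where

  All-cartesianProductWith⁺ : ∀ {P : A → Set} {Q : B → Set} {R : C → Set} {xs ys} →
    (∀ {x y} → P x → Q y → R (f x y)) →
    All P xs → All Q ys → All R (cartesianProductWith f xs ys)
  All-cartesianProductWith⁺ pres []         qys = []
  All-cartesianProductWith⁺ pres (px ∷ pxs) qys =
    All.++⁺ (All.map⁺ (All.map (pres px) qys)) (All-cartesianProductWith⁺ pres pxs qys)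

  AllPairs-cartesianProductWith⁺ :
    ∀ {R : A → A → Set} {S : B → B → Set} {U : C → C → Set} {xs ys} →
    (∀ {x x′} y y′ → R x x′ → U (f x y) (f x′ y′)) → (∀ x {y y′} → S y y′ → U (f x y) (f x y′)) →
    AllPairs R xs → AllPairs S ys → AllPairs U (cartesianProductWith f xs ys)
  AllPairs-cartesianProductWith⁺ presˡ presʳ [] sys = []
  AllPairs-cartesianProductWith⁺ {U = U} {x ∷ xs} {ys} presˡ presʳ (rx ∷ rxs) sys =
    AllPairs.++⁺ (AllPairs.map⁺ (AllPairs.map (presʳ x) sys))
                 (AllPairs-cartesianProductWith⁺ presˡ presʳ rxs sys)
                 (All.map⁺ (All.universal across ys))
    where
    across : ∀ y → All (U (f x y)) (cartesianProductWith f xs ys)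
    across y = All-cartesianProductWith⁺ {Q = λ _ → ⊤} (λ r _ → presˡ y _ r) rx
                                         (All.universal (λ _ → tt) ys)

length-++-≤-* : ∀ {A B : Set} c (xs : List A) (xs′ : List B) {ys ys′} →
  length xs ≤ c * length xs′ → length ys ≤ c * length ys′ →
  length (xs ++ ys) ≤ c * length (xs′ ++ ys′)
length-++-≤-* c xs xs′ {ys} {ys′} xs≤ ys≤ = begin
  length (xs ++ ys)                ≡⟨ length-++ xs ⟩
  length xs + length ys            ≤⟨ +-mono-≤ xs≤ ys≤ ⟩
  c * length xs′ + c * length ys′  ≡⟨ *-distribˡ-+ c (length xs′) _ ⟨
  c * (length xs′ + length ys′)    ≡⟨ cong (c *_) (length-++ xs′) ⟨
  c * length (xs′ ++ ys′)          ∎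
  where open ≤-Reasoning

sum-replicate : ∀ k n → sum (replicate k n) ≡ k * n
sum-replicate zero    n = refl
sum-replicate (suc k) n = cong (n +_) (sum-replicate k n)

Word : ℕ → Set
Word n = Vec (Fin 3) n

word : ∀ {n} → Fun3 n → Word n
word = tabulate

distinct⇒word≢ : ∀ {n} {f g : Fun3 n} → Distinct f g → word f ≢ word g
distinct⇒word≢ {f = f} {g} (v , fv≢gv) eq = fv≢gv (begin
  f v                ≡⟨ lookup∘tabulate f v ⟨
  lookupᵛ (word f) v ≡⟨ cong (λ w → lookupᵛ w v) eq ⟩
  lookupᵛ (word g) v ≡⟨ lookup∘tabulate g v ⟩
  g v                ∎)
  where open ≡-Reasoning

CoversMinimalRDFs : ∀ {n} → Graph n → List (Word n) → Set
CoversMinimalRDFs G S = ∀ f → IsMinimalRDF G f → word f ∈ S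

count-minimal≤ : ∀ {n} {G : Graph n} {S L} → CoversMinimalRDFs G S →
  AllPairs Distinct L → All (IsMinimalRDF G) L → length L ≤ length S
count-minimal≤ {S = S} {L} cover distinct minimal = subst (_≤ length S) (length-map word L)
  (unique∧⊆⇒length≤ (AllPairs.map⁺ (AllPairs.map distinct⇒word≢ distinct))
                     (All.map⁺ (All.map (cover _) minimal)))

rigid⇒minimal : ∀ {n} {G : Graph n} {f} → IsRDF G f →
  (∀ g → IsRDF G g → g ≤F f → ∀ v → g v ≡ f v) → IsMinimalRDF G f
rigid⇒minimal rdf rigid = rdf , λ g rdfg g≤f (v , gv≢fv) → gv≢fv (rigid g rdfg g≤f v)

module _ {n} {G : Graph n} {f : Fun3 n} (minimal : IsMinimalRDF G f) where

  private
    reset : Fin n → Fin 3 → Fun3 n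
    reset u y = updateAt f u (const y)

    reset-elsewhere : ∀ {u y v} → v ≢ u → toℕ (reset u y v) ≡ toℕ (f v)
    reset-elsewhere {u} {v = v} v≢u = cong toℕ (updateAt-minimal v u f v≢u)

  lowering-not-rdf : ∀ u y → toℕ y < toℕ (f u) → ¬ IsRDF G (reset u y)
  lowering-not-rdf u y y<fu rdf = proj₂ minimal (reset u y) rdf below (u , moved)
    where
    below : reset u y ≤F f
    below v with v ≟ u
    ... | yes refl = subst (λ z → toℕ z ≤ toℕ (f u)) (sym (updateAt-updates u f)) (<⇒≤ y<fu)
    ... | no v≢u   = ≤-reflexive (reset-elsewhere v≢u)
    moved : reset u y u ≢ f u
    moved eq = <⇒≢ y<fu (cong toℕ (trans (sym (updateAt-updates u f)) eq))

  one-beside-two-not-minimal : ∀ {u w} → toℕ (f u) ≡ 1 → G u w → toℕ (f w) ≡ 2 → ⊥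
  one-beside-two-not-minimal {u} {w} fu≡1 uw fw≡2 =
    lowering-not-rdf u 𝟎 (≤-reflexive (sym fu≡1)) rdf
    where
    two⇒≢u : ∀ {v} → toℕ (f v) ≡ 2 → v ≢ u
    two⇒≢u fv≡2 refl = contradiction (trans (sym fu≡1) fv≡2) λ ()
    rdf : IsRDF G (reset u 𝟎)
    rdf v rv≡0 with v ≟ u
    ... | yes refl = w , uw , trans (reset-elsewhere (two⇒≢u fw≡2)) fw≡2
    ... | no v≢u   with proj₁ minimal v (trans (sym (reset-elsewhere v≢u)) rv≡0)
    ...   | w′ , vw′ , fw′≡2 = w′ , vw′ , trans (reset-elsewhere (two⇒≢u fw′≡2)) fw′≡2

  -- Some 0-neighbour of u is dominated by u alone: otherwise u could be lowered to 1.
  two-has-private-neighbour : ∀ {u} → toℕ (f u) ≡ 2 →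
    ¬ (∀ v → G v u → toℕ (f v) ≡ 0 → ∃ λ w → w ≢ u × G v w × toℕ (f w) ≡ 2)
  two-has-private-neighbour {u} fu≡2 shared =
    lowering-not-rdf u 𝟏 (≤-reflexive (sym fu≡2)) rdf
    where
    rdf : IsRDF G (reset u 𝟏)
    rdf v rv≡0 with v ≟ u
    ... | yes refl = contradiction (trans (cong toℕ (sym (updateAt-updates u f))) rv≡0) λ ()
    ... | no v≢u   with proj₁ minimal v (trans (sym (reset-elsewhere v≢u)) rv≡0)
    ...   | w , vw , fw≡2 with w ≟ u
    ...     | no w≢u   = w , vw , trans (reset-elsewhere w≢u) fw≡2
    ...     | yes refl with shared v vw (trans (sym (reset-elsewhere v≢u)) rv≡0)
    ...       | w′ , w′≢u , vw′ , fw′≡2 = w′ , vw′ , trans (reset-elsewhere w′≢u) fw′≡2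

-- Disjoint unions and isomorphisms

data Split (m k : ℕ) : Fin (m + k) → Set where
  left  : (x : Fin m) → Split m k (x ↑ˡ k)
  right : (y : Fin k) → Split m k (m ↑ʳ y)

split : ∀ m {k} (v : Fin (m + k)) → Split m k v
split zero    v       = right v
split (suc m) zero    = left zero
split (suc m) (suc v) with split m v
... | left x  = left (suc x)
... | right y = right y

module _ {m k : ℕ} where

  restrictˡ : Fun3 (m + k) → Fun3 m
  restrictˡ f x = f (x ↑ˡ k)

  restrictʳ : Fun3 (m + k) → Fun3 k
  restrictʳ f y = f (m ↑ʳ y)

  glue : Fun3 m → Fun3 k → Fun3 (m + k)
  glue a b = [ a , b ]′ ∘ splitAt m

  glue-↑ˡ : ∀ a b x → glue a b (x ↑ˡ k) ≡ a x
  glue-↑ˡ a b x = cong [ a , b ]′ (splitAt-join m k (inj₁ x))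

  glue-↑ʳ : ∀ a b y → glue a b (m ↑ʳ y) ≡ b y
  glue-↑ʳ a b y = cong [ a , b ]′ (splitAt-join m k (inj₂ y))

  word-restrict : ∀ (f : Fun3 (m + k)) → word f ≡ word (restrictˡ f) ++ᵛ word (restrictʳ f)
  word-restrict = go m
    where
    go : ∀ m (f : Fun3 (m + k)) →
         tabulate f ≡ tabulate (f ∘ (_↑ˡ k)) ++ᵛ tabulate (f ∘ (m ↑ʳ_))
    go zero    f = refl
    go (suc m) f = cong (f zero ∷_) (go m (f ∘ suc))

  glue-distinctˡ : ∀ {a a′} b b′ → Distinct a a′ → Distinct (glue a b) (glue a′ b′)
  glue-distinctˡ b b′ (x , ax≢a′x) =
    x ↑ˡ k , λ eq → ax≢a′x (trans (sym (glue-↑ˡ _ b x)) (trans eq (glue-↑ˡ _ b′ x)))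

  glue-distinctʳ : ∀ a {b b′} → Distinct b b′ → Distinct (glue a b) (glue a b′)
  glue-distinctʳ a (y , by≢b′y) =
    m ↑ʳ y , λ eq → by≢b′y (trans (sym (glue-↑ʳ a _ y)) (trans eq (glue-↑ʳ a _ y)))

  glue-≤ : ∀ {a b f} → a ≤F restrictˡ f → b ≤F restrictʳ f → glue a b ≤F f
  glue-≤ {a} {b} a≤ b≤ v with split m v
  ... | left x  = subst (λ z → toℕ z ≤ _) (sym (glue-↑ˡ a b x)) (a≤ x)
  ... | right y = subst (λ z → toℕ z ≤ _) (sym (glue-↑ʳ a b y)) (b≤ y)

  restrictˡ-≤ : ∀ {g a b} → g ≤F glue a b → restrictˡ g ≤F a
  restrictˡ-≤ {a = a} {b} g≤ x = subst (λ z → _ ≤ toℕ z) (glue-↑ˡ a b x) (g≤ (x ↑ˡ k))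

  restrictʳ-≤ : ∀ {g a b} → g ≤F glue a b → restrictʳ g ≤F b
  restrictʳ-≤ {a = a} {b} g≤ y = subst (λ z → _ ≤ toℕ z) (glue-↑ʳ a b y) (g≤ (m ↑ʳ y))

  module _ (G : Graph m) (H : Graph k) where

    ⊕-join : ∀ p q → (G ⊕ H) (join m k p) (join m k q) ≡ adjSum G H p q
    ⊕-join p q rewrite splitAt-join m k p | splitAt-join m k q = refl

    rdf-restrictˡ : ∀ {f} → IsRDF (G ⊕ H) f → IsRDF G (restrictˡ f)
    rdf-restrictˡ rdf x fx≡0 with rdf (x ↑ˡ k) fx≡0
    ... | w , xw , fw≡2 with split m w
    ...   | left y  = y , subst id (⊕-join (inj₁ x) (inj₁ y)) xw , fw≡2
    ...   | right y = ⊥-elim (subst id (⊕-join (inj₁ x) (inj₂ y)) xw)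

    rdf-restrictʳ : ∀ {f} → IsRDF (G ⊕ H) f → IsRDF H (restrictʳ f)
    rdf-restrictʳ rdf y fy≡0 with rdf (m ↑ʳ y) fy≡0
    ... | w , yw , fw≡2 with split m w
    ...   | left x  = ⊥-elim (subst id (⊕-join (inj₂ y) (inj₁ x)) yw)
    ...   | right z = z , subst id (⊕-join (inj₂ y) (inj₂ z)) yw , fw≡2

    rdf-glue : ∀ {a b} → IsRDF G a → IsRDF H b → IsRDF (G ⊕ H) (glue a b)
    rdf-glue {a} {b} rdfa rdfb v gv≡0 with split m v
    ... | left x with rdfa x (trans (cong toℕ (sym (glue-↑ˡ a b x))) gv≡0)
    ...   | y , xy , ay≡2 = y ↑ˡ k , subst id (sym (⊕-join (inj₁ x) (inj₁ y))) xy ,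
                            trans (cong toℕ (glue-↑ˡ a b y)) ay≡2
    rdf-glue {a} {b} rdfa rdfb v gv≡0 | right x
      with rdfb x (trans (cong toℕ (sym (glue-↑ʳ a b x))) gv≡0)
    ...   | y , xy , by≡2 = m ↑ʳ y , subst id (sym (⊕-join (inj₂ x) (inj₂ y))) xy ,
                            trans (cong toℕ (glue-↑ʳ a b y)) by≡2

    minimal-restrictˡ : ∀ {f} → IsMinimalRDF (G ⊕ H) f → IsMinimalRDF G (restrictˡ f)
    minimal-restrictˡ {f} (rdf , min) = rdf-restrictˡ rdf , λ a rdfa a≤ (x , ax≢fx) →
      min (glue a (restrictʳ f)) (rdf-glue rdfa (rdf-restrictʳ rdf)) (glue-≤ a≤ (λ _ → ≤-refl))
          (x ↑ˡ k , λ eq → ax≢fx (trans (sym (glue-↑ˡ a _ x)) eq))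

    minimal-restrictʳ : ∀ {f} → IsMinimalRDF (G ⊕ H) f → IsMinimalRDF H (restrictʳ f)
    minimal-restrictʳ {f} (rdf , min) = rdf-restrictʳ rdf , λ b rdfb b≤ (y , by≢fy) →
      min (glue (restrictˡ f) b) (rdf-glue (rdf-restrictˡ rdf) rdfb) (glue-≤ (λ _ → ≤-refl) b≤)
          (m ↑ʳ y , λ eq → by≢fy (trans (sym (glue-↑ʳ _ b y)) eq))

    minimal-glue : ∀ {a b} → IsMinimalRDF G a → IsMinimalRDF H b → IsMinimalRDF (G ⊕ H) (glue a b)
    minimal-glue {a} {b} (rdfa , mina) (rdfb , minb) = rdf-glue rdfa rdfb , below
      where
      below : ∀ g → IsRDF (G ⊕ H) g → g ≤F glue a b → Distinct g (glue a b) → ⊥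
      below g rdfg g≤ (v , gv≢) with split m v
      ... | left x  = mina (restrictˡ g) (rdf-restrictˡ rdfg) (restrictˡ-≤ g≤)
                           (x , λ eq → gv≢ (trans eq (sym (glue-↑ˡ a b x))))
      ... | right y = minb (restrictʳ g) (rdf-restrictʳ rdfg) (restrictʳ-≤ g≤)
                           (y , λ eq → gv≢ (trans eq (sym (glue-↑ʳ a b y))))

    cover-⊕ : ∀ {S T} → CoversMinimalRDFs G S → CoversMinimalRDFs H T →
      CoversMinimalRDFs (G ⊕ H) (cartesianProductWith _++ᵛ_ S T)
    cover-⊕ coverG coverH f minimal = subst (_∈ _) (sym (word-restrict f))
      (∈-cartesianProductWith⁺ _++ᵛ_ (coverG _ (minimal-restrictˡ minimal))
                                      (coverH _ (minimal-restrictʳ minimal)))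

relabel : ∀ {n p} → (Fin n → Fin p) → Word p → Word n
relabel t w = tabulate (lookupᵛ w ∘ t)

module _ {n p : ℕ} {G : Graph n} {H : Graph p} (iso : Iso G H) where

  private
    σ = proj₁ iso
    to = Inverse.to σ
    from = Inverse.from σ
    to∘from : ∀ y → to (from y) ≡ y
    to∘from = Inverse.strictlyInverseˡ σ
    from∘to : ∀ x → from (to x) ≡ x
    from∘to = Inverse.strictlyInverseʳ σ
    G→H : ∀ {u v} → G u v → H (to u) (to v)
    G→H = Equivalence.to (proj₂ iso _ _)
    H→G : ∀ {u v} → H (to u) (to v) → G u v
    H→G = Equivalence.from (proj₂ iso _ _)

  minimal-transport : ∀ {f} → IsMinimalRDF G f → IsMinimalRDF H (f ∘ from)
  minimal-transport {f} (rdf , min) = rdfH , λ g rdfg g≤ (y , gy≢) →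
    min (g ∘ to) (rdf-pull rdfg)
        (λ x → subst (λ z → toℕ (g (to x)) ≤ toℕ (f z)) (from∘to x) (g≤ (to x)))
        (from y , λ eq → gy≢ (trans (sym (cong g (to∘from y))) eq))
    where
    rdfH : IsRDF H (f ∘ from)
    rdfH y fy≡0 with rdf (from y) fy≡0
    ... | u , yu , fu≡2 = to u , subst (λ z → H z (to u)) (to∘from y) (G→H yu) ,
                          trans (cong (toℕ ∘ f) (from∘to u)) fu≡2
    rdf-pull : ∀ {g} → IsRDF H g → IsRDF G (g ∘ to)
    rdf-pull {g} rdfg x gx≡0 with rdfg (to x) gx≡0
    ... | y , xy , gy≡2 = from y , H→G (subst (H (to x)) (sym (to∘from y)) xy) ,
                          trans (cong (toℕ ∘ g) (to∘from y)) gy≡2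

  cover-iso : ∀ {S} → CoversMinimalRDFs H S → CoversMinimalRDFs G (map (relabel to) S)
  cover-iso coverH f minimal =
    subst (_∈ _) relabel-word (∈-map⁺ (relabel to) (coverH _ (minimal-transport minimal)))
    where
    relabel-word : relabel to (word (f ∘ from)) ≡ word f
    relabel-word = tabulate-cong λ x →
      trans (lookup∘tabulate (f ∘ from) (to x)) (cong f (from∘to x))

-- The automaton

data Symbol : Set where
  out : Symbol
  val : Fin 3 → Symbol

is0 is2 : Symbol → Bool
is0 (val 𝟎) = true
is0 _       = false
is2 (val 𝟐) = true
is2 _       = false

-- The condition that minimality forces at a vertex of value c whose left neighbours are
-- b, a and right neighbours d, e (out where the path has ended).
ok : Symbol → Symbol → Symbol → Symbol → Symbol → Bool
ok a b out     d e = true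
ok a b (val 𝟎) d e = is2 b ∨ is2 d
ok a b (val 𝟏) d e = not (is2 b) ∧ not (is2 d)
ok a b (val 𝟐) d e = (is0 b ∧ not (is2 a)) ∨ (is0 d ∧ not (is2 e))

-- The last four symbols read: reading x settles the window centred two symbols back,
-- and at the end of the word the last two windows are closed off by out.
data State : Set where
  ⟨_,_,_,_⟩ : Symbol → Symbol → Symbol → Symbol → State

initial : State
initial = ⟨ out , out , out , out ⟩

next : State → Fin 3 → State
next ⟨ a , b , c , d ⟩ x = ⟨ b , c , d , val x ⟩

readable : State → Fin 3 → Bool
readable ⟨ a , b , c , d ⟩ x = ok a b c d (val x)

final : State → Bool
final ⟨ a , b , c , d ⟩ = ok a b c d out ∧ ok b c d out out

Accepts : ∀ {m} → State → Word m → Set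
Accepts s []      = T (final s)
Accepts s (x ∷ w) = T (readable s x) × Accepts (next s x) w

accepted : State → (m : ℕ) → List (Word m)
acceptedAfter : State → Fin 3 → (m : ℕ) → List (Word (suc m))
accepted s zero    = if final s then [ [] ] else []
accepted s (suc m) = acceptedAfter s 𝟎 m ++ acceptedAfter s 𝟏 m ++ acceptedAfter s 𝟐 m
acceptedAfter s x m = if readable s x then map (x ∷_) (accepted (next s x) m) else []

∈-acceptedAfter : ∀ {m} s x {w : Word m} → T (readable s x) → w ∈ accepted (next s x) m →
  x ∷ w ∈ acceptedAfter s x m
∈-acceptedAfter s x readable-x w∈ with readable s x
... | true = ∈-map⁺ (x ∷_) w∈

∈-accepted-suc : ∀ {m} s x {v : Word (suc m)} → v ∈ acceptedAfter s x m →
                 v ∈ accepted s (suc m)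
∈-accepted-suc s 𝟎 v∈ = ∈-++⁺ˡ v∈
∈-accepted-suc s 𝟏 v∈ = ∈-++⁺ʳ (acceptedAfter s 𝟎 _) (∈-++⁺ˡ v∈)
∈-accepted-suc s 𝟐 v∈ = ∈-++⁺ʳ (acceptedAfter s 𝟎 _) (∈-++⁺ʳ (acceptedAfter s 𝟏 _) v∈)

accepts⇒∈accepted : ∀ {m} s (w : Word m) → Accepts s w → w ∈ accepted s m
accepts⇒∈accepted s []      acc with final s
... | true = here refl
accepts⇒∈accepted s (x ∷ w) (readable-x , acc) =
  ∈-accepted-suc s x (∈-acceptedAfter s x readable-x (accepts⇒∈accepted (next s x) w acc))

count : State → ℕ → ℕ
count s m = length (accepted s m)

∀-symbol? : {P : Symbol → Set} → (∀ s → Dec (P s)) → Dec (∀ s → P s)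
∀-symbol? P? = map′ (λ { (p , _ , _ , _) out → p ; (_ , p , _ , _) (val 𝟎) → p
                       ; (_ , _ , p , _) (val 𝟏) → p ; (_ , _ , _ , p) (val 𝟐) → p })
                    (λ h → h out , h (val 𝟎) , h (val 𝟏) , h (val 𝟐))
                    (P? out ×-dec P? (val 𝟎) ×-dec P? (val 𝟏) ×-dec P? (val 𝟐))

∀-state? : {P : State → Set} → (∀ s → Dec (P s)) → Dec (∀ s → P s)
∀-state? P? = map′ (λ h → λ { ⟨ a , b , c , d ⟩ → h a b c d }) (λ h a b c d → h ⟨ a , b , c , d ⟩)
                   (∀-symbol? λ a → ∀-symbol? λ b → ∀-symbol? λ c → ∀-symbol? λ d →
                      P? ⟨ a , b , c , d ⟩)

count-step : ∀ k → (∀ s → count s (2 + k) ≤ 3 * count s k) →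
             ∀ s → count s (3 + k) ≤ 3 * count s (suc k)
count-step k growth s =
  length-++-≤-* 3 (acceptedAfter s 𝟎 (2 + k)) (acceptedAfter s 𝟎 k) (after 𝟎)
    (length-++-≤-* 3 (acceptedAfter s 𝟏 (2 + k)) (acceptedAfter s 𝟏 k) (after 𝟏) (after 𝟐))
  where
  after : ∀ x → length (acceptedAfter s x (2 + k)) ≤ 3 * length (acceptedAfter s x k)
  after x with readable s x
  ... | false = z≤n
  ... | true  = subst₂ (λ a b → a ≤ 3 * b) (sym (length-map (x ∷_) (accepted (next s x) (2 + k))))
                       (sym (length-map (x ∷_) (accepted (next s x) k))) (growth (next s x))

-- Checked by evaluation over all 4⁴ states.
count-growth : ∀ j s → count s (5 + j) ≤ 3 * count s (3 + j)
count-growth zero    = from-yes (∀-state? λ s → count s 5 ≤? 3 * count s 3)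
count-growth (suc j) = count-step (3 + j) (count-growth j)

count-initial-bound : ∀ m → count initial m ^ 2 ≤ 3 ^ m
count-initial-bound 0 = from-yes (count initial 0 ^ 2 ≤? 3 ^ 0)
count-initial-bound 1 = from-yes (count initial 1 ^ 2 ≤? 3 ^ 1)
count-initial-bound 2 = from-yes (count initial 2 ^ 2 ≤? 3 ^ 2)
count-initial-bound 3 = from-yes (count initial 3 ^ 2 ≤? 3 ^ 3)
count-initial-bound 4 = from-yes (count initial 4 ^ 2 ≤? 3 ^ 4)
count-initial-bound (suc (suc m@(suc (suc (suc j))))) = begin
  count initial (2 + m) ^ 2  ≤⟨ ^-monoˡ-≤ 2 (count-growth j initial) ⟩
  (3 * count initial m) ^ 2  ≡⟨ ^-distrib-* 3 (count initial m) 2 ⟩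
  9 * count initial m ^ 2    ≤⟨ *-monoʳ-≤ 9 (count-initial-bound m) ⟩
  9 * 3 ^ m                  ≡⟨ *-assoc 3 3 (3 ^ m) ⟩
  3 ^ (2 + m)                ∎
  where open ≤-Reasoning

_!_ : List Symbol → ℕ → Symbol
[]       ! _     = out
(s ∷ ss) ! zero  = s
(s ∷ ss) ! suc j = ss ! j

WindowOk : List Symbol → ℕ → Set
WindowOk ss j = T (ok (ss ! j) (ss ! (1 + j)) (ss ! (2 + j)) (ss ! (3 + j)) (ss ! (4 + j)))

symbols : ∀ {m} → State → Word m → List Symbol
symbols ⟨ a , b , c , d ⟩ w = a ∷ b ∷ c ∷ d ∷ map val (toList w)

windows⇒accepts : ∀ {m} s (w : Word m) → (∀ j → WindowOk (symbols s w) j) → Accepts s w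
windows⇒accepts ⟨ a , b , c , d ⟩ []      windows = Equivalence.from T-∧ (windows 0 , windows 1)
windows⇒accepts ⟨ a , b , c , d ⟩ (x ∷ w) windows =
  windows 0 , windows⇒accepts _ w (windows ∘ suc)

T-is2 : ∀ {s x} → s ≡ val x → toℕ x ≡ 2 → T (is2 s)
T-is2 {x = 𝟎} _    ()
T-is2 {x = 𝟏} _    ()
T-is2 {x = 𝟐} refl _ = _

T-not-is2 : ∀ s → s ≢ val 𝟐 → T (not (is2 s))
T-not-is2 out     _   = _
T-not-is2 (val 𝟎) _   = _
T-not-is2 (val 𝟏) _   = _
T-not-is2 (val 𝟐) s≢2 = s≢2 refl

¬T-not-is2 : ∀ s → ¬ T (not (is2 s)) → s ≡ val 𝟐
¬T-not-is2 out     ¬t = ⊥-elim (¬t _)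
¬T-not-is2 (val 𝟎) ¬t = ⊥-elim (¬t _)
¬T-not-is2 (val 𝟏) ¬t = ⊥-elim (¬t _)
¬T-not-is2 (val 𝟐) _  = refl

no-private-left : ∀ {a b d e} → b ≡ val 𝟎 → ¬ T (ok a b (val 𝟐) d e) → a ≡ val 𝟐
no-private-left {a} refl ¬ok = ¬T-not-is2 a (¬ok ∘ Equivalence.from T-∨ ∘ inj₁)

no-private-right : ∀ {a b d e} → d ≡ val 𝟎 → ¬ T (ok a b (val 𝟐) d e) → e ≡ val 𝟐
no-private-right {e = e} refl ¬ok = ¬T-not-is2 e (¬ok ∘ Equivalence.from T-∨ ∘ inj₂)

padded : ∀ {m} → Fun3 m → List Symbol
padded f = out ∷ out ∷ map val (toList (word f))

padded-vertex : ∀ {m} (f : Fun3 m) u → padded f ! (2 + toℕ u) ≡ val (f u)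
padded-vertex f zero    = refl
padded-vertex f (suc u) = padded-vertex (f ∘ suc) u

padded-val : ∀ {m} (f : Fun3 m) j {x} → padded f ! j ≡ val x → ∃ λ u → 2 + toℕ u ≡ j × f u ≡ x
padded-val {zero}  f (suc (suc i))       ()
padded-val {suc m} f 2                   refl = zero , refl , refl
padded-val {suc m} f (suc (suc (suc i))) eq with padded-val (f ∘ suc) (2 + i) eq
... | u , refl , fu≡x = suc u , refl , fu≡x

2+toℕ≡⇒≢ : ∀ {m} {u w : Fin m} → 2 + toℕ u ≡ toℕ w → u ≢ w
2+toℕ≡⇒≢ {u = u} eq refl = <⇒≢ (m<n+m (toℕ u) z<s) (sym eq)

-- In padded f the window of u spans the positions toℕ u, …, 4 + toℕ u.
module _ {m} {f : Fun3 m} (minimal : IsMinimalRDF (Path m) f) where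

  private
    P = padded f

  left-symbol : ∀ {u v : Fin m} → toℕ u ≡ suc (toℕ v) → P ! (1 + toℕ u) ≡ val (f v)
  left-symbol {v = v} u≡1+v = trans (cong (λ i → P ! (1 + i)) u≡1+v) (padded-vertex f v)

  right-symbol : ∀ {u v : Fin m} → toℕ v ≡ suc (toℕ u) → P ! (3 + toℕ u) ≡ val (f v)
  right-symbol {v = v} v≡1+u = trans (cong (λ i → P ! (2 + i)) (sym v≡1+u)) (padded-vertex f v)

  left-vertex : ∀ {u x} → P ! (1 + toℕ u) ≡ val x → ∃ λ w → Path m u w × toℕ (f w) ≡ toℕ x
  left-vertex eq with padded-val f _ eq
  ... | w , w+2≡u+1 , fw≡x = w , inj₂ (sym (suc-injective w+2≡u+1)) , cong toℕ fw≡x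

  right-vertex : ∀ {u x} → P ! (3 + toℕ u) ≡ val x → ∃ λ w → Path m u w × toℕ (f w) ≡ toℕ x
  right-vertex eq with padded-val f _ eq
  ... | w , w+2≡u+3 , fw≡x = w , inj₁ (suc-injective (suc-injective w+2≡u+3)) , cong toℕ fw≡x

  second-left-vertex : ∀ {u v x} → toℕ u ≡ suc (toℕ v) → P ! toℕ u ≡ val x →
                       ∃ λ w → w ≢ u × Path m v w × toℕ (f w) ≡ toℕ x
  second-left-vertex u≡1+v eq with padded-val f _ eq
  ... | w , w+2≡u , fw≡x =
    w , 2+toℕ≡⇒≢ w+2≡u , inj₂ (suc-injective (trans (sym u≡1+v) (sym w+2≡u))) , cong toℕ fw≡x

  second-right-vertex : ∀ {u v x} → toℕ v ≡ suc (toℕ u) → P ! (4 + toℕ u) ≡ val x →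
                        ∃ λ w → w ≢ u × Path m v w × toℕ (f w) ≡ toℕ x
  second-right-vertex v≡1+u eq with padded-val f _ eq
  ... | w , w+2≡u+4 , fw≡x with suc-injective (suc-injective w+2≡u+4)
  ...   | w≡2+u = w , ≢-sym (2+toℕ≡⇒≢ (sym w≡2+u)) , inj₁ (trans w≡2+u (cong suc (sym v≡1+u))) ,
                  cong toℕ fw≡x

  window-ok : ∀ u → WindowOk P (toℕ u)
  window-ok u = subst (λ c → T (ok a b c d e)) (sym (padded-vertex f u)) (centred (f u) refl)
    where
    a b d e : Symbol
    a = P ! toℕ u
    b = P ! (1 + toℕ u)
    d = P ! (3 + toℕ u)
    e = P ! (4 + toℕ u)
    centred : ∀ x → f u ≡ x → T (ok a b (val x) d e)
    centred 𝟎 fu≡0 with proj₁ minimal u (cong toℕ fu≡0)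
    ... | w , uw , fw≡2 = Equivalence.from T-∨
      ([ (λ w≡1+u → inj₂ (T-is2 (right-symbol w≡1+u) fw≡2)) ,
         (λ u≡1+w → inj₁ (T-is2 (left-symbol u≡1+w) fw≡2)) ]′ uw)
    centred 𝟏 fu≡1 = Equivalence.from T-∧ (T-not-is2 b (no-two ∘ left-vertex) ,
                                           T-not-is2 d (no-two ∘ right-vertex))
      where
      no-two : ¬ ∃ λ w → Path m u w × toℕ (f w) ≡ 2
      no-two (w , uw , fw≡2) = one-beside-two-not-minimal minimal (cong toℕ fu≡1) uw fw≡2
    centred 𝟐 fu≡2 with T? (ok a b (val 𝟐) d e)
    ... | yes ok-u = ok-u
    ... | no ¬ok-u = ⊥-elim (two-has-private-neighbour minimal (cong toℕ fu≡2) shared)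
      where
      val-zero : ∀ {v} → toℕ (f v) ≡ 0 → val (f v) ≡ val 𝟎
      val-zero fv≡0 = cong val (toℕ-injective fv≡0)
      shared : ∀ v → Path m v u → toℕ (f v) ≡ 0 → ∃ λ w → w ≢ u × Path m v w × toℕ (f w) ≡ 2
      shared v (inj₁ u≡1+v) fv≡0 = second-left-vertex u≡1+v
        (no-private-left {a} {b} {d} {e} (trans (left-symbol u≡1+v) (val-zero fv≡0)) ¬ok-u)
      shared v (inj₂ v≡1+u) fv≡0 = second-right-vertex v≡1+u
        (no-private-right {a} {b} {d} {e} (trans (right-symbol v≡1+u) (val-zero fv≡0)) ¬ok-u)

  accepts-word : Accepts initial (word f)
  accepts-word = windows⇒accepts initial (word f) windows
    where
    windows : ∀ j → WindowOk (out ∷ out ∷ P) j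
    windows 0 = _
    windows 1 = _
    windows (suc (suc i)) with P ! (2 + i) in centre
    ... | out   = _
    ... | val x with padded-val f (2 + i) centre
    ...   | u , refl , _ =
      subst (λ c → T (ok (P ! toℕ u) (P ! (1 + toℕ u)) c (P ! (3 + toℕ u)) (P ! (4 + toℕ u))))
            centre (window-ok u)

cover-Path : ∀ m → CoversMinimalRDFs (Path m) (accepted initial m)
cover-Path m f minimal = accepts⇒∈accepted initial (word f) (accepts-word minimal)

-- The upper bound

pathUnionWords : ∀ ls → List (Word (sum ls))
pathUnionWords []       = [ [] ]
pathUnionWords (l ∷ ls) = cartesianProductWith _++ᵛ_ (accepted initial l) (pathUnionWords ls)

cover-PathUnion : ∀ ls → CoversMinimalRDFs (PathUnion ls) (pathUnionWords ls)
cover-PathUnion []       f _ = here refl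
cover-PathUnion (l ∷ ls) = cover-⊕ (Path l) (PathUnion ls) (cover-Path l) (cover-PathUnion ls)

pathUnionWords-bound : ∀ ls → length (pathUnionWords ls) ^ 2 ≤ 3 ^ sum ls
pathUnionWords-bound []       = ≤-refl
pathUnionWords-bound (l ∷ ls) = begin
  length (pathUnionWords (l ∷ ls)) ^ 2
    ≡⟨ cong (_^ 2) (length-cartesianProductWith _++ᵛ_ (accepted initial l) (pathUnionWords ls)) ⟩
  (count initial l * length (pathUnionWords ls)) ^ 2
    ≡⟨ ^-distrib-* (count initial l) (length (pathUnionWords ls)) 2 ⟩
  count initial l ^ 2 * length (pathUnionWords ls) ^ 2
    ≤⟨ *-mono-≤ (count-initial-bound l) (pathUnionWords-bound ls) ⟩
  3 ^ l * 3 ^ sum ls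
    ≡⟨ ^-distribˡ-+-* 3 l (sum ls) ⟨
  3 ^ (l + sum ls) ∎
  where open ≤-Reasoning

minimal-rdfs-bound : ∀ {n} {G : Graph n} → IsDisjointUnionOfPaths G →
  ∀ {L} → AllPairs Distinct L → All (IsMinimalRDF G) L → length L ^ 2 ≤ 3 ^ n
minimal-rdfs-bound {n} (ls , iso) {L} distinct minimal = begin
  length L ^ 2
    ≤⟨ ^-monoˡ-≤ 2 (count-minimal≤ (cover-iso {H = PathUnion ls} iso (cover-PathUnion ls))
                                   distinct minimal) ⟩
  length (map (relabel _) (pathUnionWords ls)) ^ 2
    ≡⟨ cong (_^ 2) (length-map (relabel _) (pathUnionWords ls)) ⟩
  length (pathUnionWords ls) ^ 2
    ≤⟨ pathUnionWords-bound ls ⟩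
  3 ^ sum ls
    ≡⟨ cong (3 ^_) (↔⇒≡ (proj₁ iso)) ⟨
  3 ^ n ∎
  where open ≤-Reasoning

-- The lower bound

P2-neighbour : ∀ {v w : Fin 2} → Path 2 v w → w ≡ opposite v
P2-neighbour {zero}     {zero}     (inj₁ ())
P2-neighbour {zero}     {zero}     (inj₂ ())
P2-neighbour {zero}     {suc zero} _ = refl
P2-neighbour {suc zero} {zero}     _ = refl
P2-neighbour {suc zero} {suc zero} (inj₁ ())
P2-neighbour {suc zero} {suc zero} (inj₂ ())

P2-partner : ∀ {g} → IsRDF (Path 2) g → ∀ v → toℕ (g v) ≡ 0 → toℕ (g (opposite v)) ≡ 2
P2-partner {g} rdf v gv≡0 with rdf v gv≡0
... | w , vw , gw≡2 = subst (λ u → toℕ (g u) ≡ 2) (P2-neighbour vw) gw≡2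

twoZero zeroTwo oneOne : Fun3 2
twoZero = lookupᵛ (𝟐 ∷ 𝟎 ∷ [])
zeroTwo = lookupᵛ (𝟎 ∷ 𝟐 ∷ [])
oneOne  = lookupᵛ (𝟏 ∷ 𝟏 ∷ [])

minimal-twoZero : IsMinimalRDF (Path 2) twoZero
minimal-twoZero = rigid⇒minimal rdf rigid
  where
  rdf : IsRDF (Path 2) twoZero
  rdf zero       ()
  rdf (suc zero) _  = zero , inj₂ refl , refl
  rigid : ∀ g → IsRDF (Path 2) g → g ≤F twoZero → ∀ v → g v ≡ twoZero v
  rigid g rdfg g≤ zero       = toℕ-injective (P2-partner rdfg (suc zero) (n≤0⇒n≡0 (g≤ (suc zero))))
  rigid g rdfg g≤ (suc zero) = toℕ-injective (n≤0⇒n≡0 (g≤ (suc zero)))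

minimal-zeroTwo : IsMinimalRDF (Path 2) zeroTwo
minimal-zeroTwo = rigid⇒minimal rdf rigid
  where
  rdf : IsRDF (Path 2) zeroTwo
  rdf zero       _  = suc zero , inj₁ refl , refl
  rdf (suc zero) ()
  rigid : ∀ g → IsRDF (Path 2) g → g ≤F zeroTwo → ∀ v → g v ≡ zeroTwo v
  rigid g rdfg g≤ zero       = toℕ-injective (n≤0⇒n≡0 (g≤ zero))
  rigid g rdfg g≤ (suc zero) = toℕ-injective (P2-partner rdfg zero (n≤0⇒n≡0 (g≤ zero)))

minimal-oneOne : IsMinimalRDF (Path 2) oneOne
minimal-oneOne = rigid⇒minimal rdf rigid
  where
  rdf : IsRDF (Path 2) oneOne
  rdf zero       ()
  rdf (suc zero) ()
  rigid : ∀ g → IsRDF (Path 2) g → g ≤F oneOne → ∀ v → g v ≡ oneOne v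
  rigid g rdfg g≤ = λ { zero → is-one zero ; (suc zero) → is-one (suc zero) }
    where
    at-most-one : ∀ v → toℕ (g v) ≤ 1
    at-most-one zero       = g≤ zero
    at-most-one (suc zero) = g≤ (suc zero)
    is-one : ∀ v → g v ≡ 𝟏
    is-one v with g v in gv | at-most-one v
    ... | 𝟎 | _ = contradiction (subst (_≤ 1) (P2-partner rdfg v (cong toℕ gv))
                                              (at-most-one (opposite v)))
                                λ { (s≤s ()) }
    ... | 𝟏 | _ = refl
    ... | 𝟐 | s≤s ()

minimalsP2 : List (Fun3 2)
minimalsP2 = twoZero ∷ zeroTwo ∷ oneOne ∷ []

minimalsKP2 : ∀ k → List (Fun3 (sum (replicate k 2)))
minimalsKP2 zero    = (λ ()) ∷ []
minimalsKP2 (suc k) = cartesianProductWith glue minimalsP2 (minimalsKP2 k)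

length-minimalsKP2 : ∀ k → length (minimalsKP2 k) ≡ 3 ^ k
length-minimalsKP2 zero    = refl
length-minimalsKP2 (suc k) = trans (length-cartesianProductWith glue minimalsP2 (minimalsKP2 k))
                                   (cong (3 *_) (length-minimalsKP2 k))

minimal-minimalsKP2 : ∀ k → All (IsMinimalRDF (kP2 k)) (minimalsKP2 k)
minimal-minimalsKP2 zero    = ((λ ()) , λ { _ _ _ (() , _) }) ∷ []
minimal-minimalsKP2 (suc k) = All-cartesianProductWith⁺ glue (minimal-glue (Path 2) (kP2 k))
  (minimal-twoZero ∷ minimal-zeroTwo ∷ minimal-oneOne ∷ []) (minimal-minimalsKP2 k)

distinct-minimalsKP2 : ∀ k → AllPairs Distinct (minimalsKP2 k)
distinct-minimalsKP2 zero    = [] ∷ []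
distinct-minimalsKP2 (suc k) = AllPairs-cartesianProductWith⁺ glue glue-distinctˡ glue-distinctʳ
  (((zero , λ ()) ∷ (zero , λ ()) ∷ []) ∷ ((zero , λ ()) ∷ []) ∷ [] ∷ []) (distinct-minimalsKP2 k)

length-minimalsKP2-square : ∀ k → length (minimalsKP2 k) ^ 2 ≡ 3 ^ sum (replicate k 2)
length-minimalsKP2-square k = begin
  length (minimalsKP2 k) ^ 2 ≡⟨ cong (_^ 2) (length-minimalsKP2 k) ⟩
  (3 ^ k) ^ 2                ≡⟨ ^-*-assoc 3 k 2 ⟩
  3 ^ (k * 2)                ≡⟨ cong (3 ^_) (sum-replicate k 2) ⟨
  3 ^ sum (replicate k 2)    ∎
  where open ≡-Reasoning

corollary3 : Σ ℕ λ C →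
    ((n : ℕ) (G : Graph n) → IsDisjointUnionOfPaths G →
      (L : List (Fun3 n)) → AllPairs Distinct L → All (IsMinimalRDF G) L →
      length L ^ 2 ≤ C * 3 ^ n)
    × ((k : ℕ) → Σ (List (Fun3 (sum (replicate k 2)))) λ L →
      AllPairs Distinct L × All (IsMinimalRDF (kP2 k)) L ×
      3 ^ sum (replicate k 2) ≤ length L ^ 2)
corollary3 =
  1 ,
  (λ n G paths L distinct minimal → subst (length L ^ 2 ≤_) (sym (*-identityˡ (3 ^ n)))
                                          (minimal-rdfs-bound paths distinct minimal)) ,
  (λ k → minimalsKP2 k , distinct-minimalsKP2 k , minimal-minimalsKP2 k ,
         ≤-reflexive (sym (length-minimalsKP2-square k)))
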